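{- Let $\mathcal{H}=(V,H)$ be a matroid of dimension $1$. Then the following conditions are equivalent: (i) $\mathcal{H}$ admits a proper matroid extension; (ii) the graph $(V, H\cap P_2(V))$ is not a complete bipartite graph; (iii) there exists some $X\in P_3(V)$ such that $P_2(X)\subseteq H$.
   Context: A simplicial complex is a pair $(V,H)$ with $V$ finite nonempty, $H\subseteq 2^V$ containing all singletons and closed under subsets; its dimension is $\max\{|X|:X\in H\}-1$; it is a matroid if for all $I,J\in H$ with $|I|=|J|+1$ there is $i\in I\setminus J$ with $J\cup\{i\}\in H$. A complex of dimension $1$ is viewed as the graph with vertex set $V$ and edge set $H\cap P_2(V)$. $P_k(V)$ (resp. $P_{\le k}(V)$) is the set of subsets of $V$ with exactly (resp. at most) $k$ elements. An extension of a complex $(V,H)$ of dimension $d$ is a complex $(V,H')$ with $H'\cap P_{\le d+1}(V)=H$; it is proper if $H'\ne H$. -}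

module Defs where

open import Data.Nat using (ℕ; suc; _≤_)
open import Data.Bool using (Bool; true; false)
open import Data.Fin using (Fin)
open import Data.Fin.Subset using (Subset; ⁅_⁆; _∪_; _∈_; _∉_; _⊆_; ∣_∣)
open import Data.Product using (Σ; ∃; _×_)
open import Data.Sum using (_⊎_)
open import Relation.Nullary using (¬_)
open import Relation.Binary.PropositionalEquality using (_≡_; _≢_)
open import Function.Bundles using (_⇔_)

-- A simplicial complex on the vertex set V = Fin n.
-- H ⊆ 2^V is given by its (Boolean) characteristic function.
record Complex (n : ℕ) : Set where
  field
    H          : Subset n → Bool
    singletons : ∀ (x : Fin n) → H ⁅ x ⁆ ≡ true
    downClosed : ∀ (X Y : Subset n) → Y ⊆ X → H X ≡ true → H Y ≡ true

open Complex public

HasDimension : ∀ {n} → Complex n → ℕ → Set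
HasDimension {n} C d =
  (Σ (Subset n) λ X → (H C X ≡ true) × (∣ X ∣ ≡ suc d))
  × (∀ (X : Subset n) → H C X ≡ true → ∣ X ∣ ≤ suc d)

IsMatroid : ∀ {n} → Complex n → Set
IsMatroid {n} C =
  ∀ (I J : Subset n) → H C I ≡ true → H C J ≡ true → ∣ I ∣ ≡ suc ∣ J ∣ →
  Σ (Fin n) λ i → (i ∈ I) × (i ∉ J) × (H C (J ∪ ⁅ i ⁆) ≡ true)

IsExtension : ∀ {n} → (d : ℕ) → Complex n → Complex n → Set
IsExtension {n} d C C' =
  ∀ (X : Subset n) → ∣ X ∣ ≤ suc d → H C' X ≡ H C X

IsProper : ∀ {n} → Complex n → Complex n → Set
IsProper {n} C C' = ¬ (∀ (X : Subset n) → H C' X ≡ H C X)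

AdmitsProperMatroidExtension : ∀ {n} → ℕ → Complex n → Set
AdmitsProperMatroidExtension {n} d C =
  Σ (Complex n) λ C' → IsExtension d C C' × IsProper C C' × IsMatroid C'

Edge : ∀ {n} → Complex n → Fin n → Fin n → Set
Edge C u v = H C (⁅ u ⁆ ∪ ⁅ v ⁆) ≡ true

IsCompleteBipartite : ∀ {n} → Complex n → Set
IsCompleteBipartite {n} C =
  Σ (Subset n) λ A →
    (∃ λ a → a ∈ A) × (∃ λ b → b ∉ A) ×
    (∀ (u v : Fin n) → u ≢ v →
       Edge C u v ⇔ ((u ∈ A × v ∉ A) ⊎ (u ∉ A × v ∈ A)))

HasTriangle : ∀ {n} → Complex n → Set
HasTriangle {n} C =
  Σ (Subset n) λ X → (∣ X ∣ ≡ 3) ×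
    (∀ (Y : Subset n) → Y ⊆ X → ∣ Y ∣ ≡ 2 → H C Y ≡ true)

module Submission where

-- In a matroid of dimension 1, exchanging a vertex v against an edge uw joins v to u or to w, so
-- non-adjacency is an equivalence relation: the graph is complete multipartite, with at least two
-- parts since it has an edge. It is complete bipartite exactly when there are only two parts, i.e.
-- when it has no triangle, and then every extension is trivial, since a face with three vertices
-- would span a triangle. Otherwise adding all triangles as 2-faces gives a proper extension which is
-- again a matroid: the vertices of a triangle lie in three different parts, so one of them avoids
-- the parts of both ends of a given edge and extends that edge to a triangle.

open import Defs
open import Data.Nat using (ℕ; suc; _≤_; _<_; _≤?_; s≤s; z≤n)
open import Data.Nat.Properties using (<⇒≱; n≤0⇒n≡0; ≤-trans; ≤-reflexive; ≤-antisym; n≤1+n; m≤n⇒m≤1+n; ≰⇒>; suc-injective)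
open import Data.Bool using (true; false)
open import Data.Bool.Properties using (T-≡; ⇔→≡) renaming (_≟_ to _≟ᵇ_)
open import Data.Fin using (Fin; zero; suc)
open import Data.Fin.Properties using (any?; all?) renaming (_≟_ to _≟ᶠ_)
open import Data.Fin.Subset using (Subset; ⁅_⁆; _∪_; _∈_; _∉_; _⊆_; ∣_∣) renaming (⊥ to ∅)
open import Data.Fin.Subset.Properties
  using (_∈?_; x∈p∪q⁻; x∈p∪q⁺; x∈⁅x⁆; x∈⁅y⁆⇒x≡y; x≢y⇒x∉⁅y⁆; ∣⁅x⁆∣≡1; ∣⊥∣≡0; p⊆q⇒∣p∣≤∣q∣; ∪-identityʳ; ∪-idem; ∉⊥; x∉⁅y⁆⇒x≢y)
open import Data.Vec using (_∷_; here; there; tabulate)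
open import Data.Vec.Properties using (lookup∘tabulate; []=⇒lookup; lookup⇒[]=)
open import Data.Product using (∃; ∃₂; _×_; _,_; proj₂)
open import Data.Sum using (_⊎_; inj₁; inj₂)
open import Data.Empty using (⊥; ⊥-elim)
open import Function using (_∘_; case_of_)
open import Function.Bundles using (_⇔_; mk⇔; Equivalence)
open import Level using (0ℓ)
open import Relation.Binary using (Rel; IsDecEquivalence; Transitive)
open import Relation.Unary using (Pred) renaming (Decidable to Decidable₁)
open import Relation.Nullary using (¬_; Dec; yes; no; ¬?)
open import Relation.Nullary.Decidable using (isYes; toWitness; fromWitness; decidable-stable; map′; _×-dec_; _→-dec_)
open import Relation.Binary.PropositionalEquality using (_≡_; _≢_; refl; sym; trans; cong; subst)

isYes≡true⇔ : ∀ {p} {P : Set p} (P? : Dec P) → isYes P? ≡ true ⇔ P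
isYes≡true⇔ P? = mk⇔ (toWitness ∘ Equivalence.from T-≡) (Equivalence.to T-≡ ∘ fromWitness)

module _ {a ℓ} {A : Set a} {_≈_ : Rel A ℓ} (≈-isDecEquivalence : IsDecEquivalence _≈_) where
  open IsDecEquivalence ≈-isDecEquivalence using (_≟_) renaming (sym to ≈-sym; trans to ≈-trans)

  ≉-either : ∀ {y z} → ¬ y ≈ z → ∀ s → ¬ y ≈ s ⊎ ¬ z ≈ s
  ≉-either {y} y≉z s with y ≟ s
  ... | no  y≉s = inj₁ y≉s
  ... | yes y≈s = inj₂ λ z≈s → y≉z (≈-trans y≈s (≈-sym z≈s))

  ≈-≉⇒≉ : ∀ {x r w} → x ≈ r → ¬ x ≈ w → ¬ w ≈ r
  ≈-≉⇒≉ x≈r x≉w w≈r = x≉w (≈-trans x≈r (≈-sym w≈r))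

  module _ {p} {P : Pred A p} {x y z} (Px : P x) (Py : P y) (Pz : P z)
           (x≉y : ¬ x ≈ y) (x≉z : ¬ x ≈ z) (y≉z : ¬ y ≈ z) where

    ≉-avoid₂-from : ∀ {r} → x ≈ r → ∀ u → ∃ λ i → P i × ¬ i ≈ r × ¬ i ≈ u
    ≉-avoid₂-from x≈r u with ≉-either y≉z u
    ... | inj₁ y≉u = y , Py , ≈-≉⇒≉ x≈r x≉y , y≉u
    ... | inj₂ z≉u = z , Pz , ≈-≉⇒≉ x≈r x≉z , z≉u

    ≉-avoid₂ : ∀ s t → ∃ λ i → P i × ¬ i ≈ s × ¬ i ≈ t
    ≉-avoid₂ s t with x ≟ s | x ≟ t
    ... | no x≉s  | no x≉t  = x , Px , x≉s , x≉t
    ... | yes x≈s | _       = ≉-avoid₂-from x≈s t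
    ... | no _    | yes x≈t with ≉-avoid₂-from x≈t s
    ...   | i , Pi , i≉t , i≉s = i , Pi , i≉s , i≉t

∣p∪⁅x⁆∣≡1+∣p∣ : ∀ {n} {p : Subset n} {x} → x ∉ p → ∣ p ∪ ⁅ x ⁆ ∣ ≡ suc ∣ p ∣
∣p∪⁅x⁆∣≡1+∣p∣ {p = true  ∷ p} {zero}  x∉p = ⊥-elim (x∉p here)
∣p∪⁅x⁆∣≡1+∣p∣ {p = false ∷ p} {zero}  x∉p = cong (suc ∘ ∣_∣) (∪-identityʳ p)
∣p∪⁅x⁆∣≡1+∣p∣ {p = true  ∷ p} {suc x} x∉p = cong suc (∣p∪⁅x⁆∣≡1+∣p∣ (x∉p ∘ there))
∣p∪⁅x⁆∣≡1+∣p∣ {p = false ∷ p} {suc x} x∉p = ∣p∪⁅x⁆∣≡1+∣p∣ (x∉p ∘ there)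

module _ {n : ℕ} where

  ⁅x⁆⊆p : ∀ {x} {p : Subset n} → x ∈ p → ⁅ x ⁆ ⊆ p
  ⁅x⁆⊆p {x} {p} x∈p u∈⁅x⁆ = subst (_∈ p) (sym (x∈⁅y⁆⇒x≡y x u∈⁅x⁆)) x∈p

  ∪-⊆ : ∀ {p q r : Subset n} → p ⊆ r → q ⊆ r → p ∪ q ⊆ r
  ∪-⊆ {p} {q} p⊆r q⊆r u∈p∪q with x∈p∪q⁻ p q u∈p∪q
  ... | inj₁ u∈p = p⊆r u∈p
  ... | inj₂ u∈q = q⊆r u∈q

  ⁅x⁆∪⁅y⁆⊆p : ∀ {x y} {p : Subset n} → x ∈ p → y ∈ p → ⁅ x ⁆ ∪ ⁅ y ⁆ ⊆ p
  ⁅x⁆∪⁅y⁆⊆p x∈p y∈p = ∪-⊆ (⁅x⁆⊆p x∈p) (⁅x⁆⊆p y∈p)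

  ∈⁅x⁆∪⁅y⁆⁻ : ∀ {u x y : Fin n} → u ∈ ⁅ x ⁆ ∪ ⁅ y ⁆ → u ≡ x ⊎ u ≡ y
  ∈⁅x⁆∪⁅y⁆⁻ {x = x} {y} u∈ with x∈p∪q⁻ ⁅ x ⁆ ⁅ y ⁆ u∈
  ... | inj₁ u∈⁅x⁆ = inj₁ (x∈⁅y⁆⇒x≡y x u∈⁅x⁆)
  ... | inj₂ u∈⁅y⁆ = inj₂ (x∈⁅y⁆⇒x≡y y u∈⁅y⁆)

  ∣p∪⁅x⁆∣≤1+∣p∣ : ∀ (p : Subset n) x → ∣ p ∪ ⁅ x ⁆ ∣ ≤ suc ∣ p ∣
  ∣p∪⁅x⁆∣≤1+∣p∣ p x with x ∈? p
  ... | no  x∉p = ≤-reflexive (∣p∪⁅x⁆∣≡1+∣p∣ x∉p)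
  ... | yes x∈p = m≤n⇒m≤1+n (p⊆q⇒∣p∣≤∣q∣ (∪-⊆ (λ u∈p → u∈p) (⁅x⁆⊆p x∈p)))

  ∣⁅x⁆∪⁅y⁆∣≤2 : ∀ (x y : Fin n) → ∣ ⁅ x ⁆ ∪ ⁅ y ⁆ ∣ ≤ 2
  ∣⁅x⁆∪⁅y⁆∣≤2 x y = ≤-trans (∣p∪⁅x⁆∣≤1+∣p∣ ⁅ x ⁆ y) (≤-reflexive (cong suc (∣⁅x⁆∣≡1 x)))

  ∣⁅x⁆∪⁅y⁆∣≡2 : ∀ {x y : Fin n} → x ≢ y → ∣ ⁅ x ⁆ ∪ ⁅ y ⁆ ∣ ≡ 2
  ∣⁅x⁆∪⁅y⁆∣≡2 {x} x≢y = trans (∣p∪⁅x⁆∣≡1+∣p∣ (x≢y⇒x∉⁅y⁆ (x≢y ∘ sym))) (cong suc (∣⁅x⁆∣≡1 x))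

  ∣⁅x⁆∪⁅y⁆∪⁅z⁆∣≡3 : ∀ {x y z : Fin n} → x ≢ y → x ≢ z → y ≢ z → ∣ (⁅ x ⁆ ∪ ⁅ y ⁆) ∪ ⁅ z ⁆ ∣ ≡ 3
  ∣⁅x⁆∪⁅y⁆∪⁅z⁆∣≡3 {x} {y} {z} x≢y x≢z y≢z = trans (∣p∪⁅x⁆∣≡1+∣p∣ z∉) (cong suc (∣⁅x⁆∪⁅y⁆∣≡2 x≢y))
    where
    z∉ : z ∉ ⁅ x ⁆ ∪ ⁅ y ⁆
    z∉ z∈ with ∈⁅x⁆∪⁅y⁆⁻ z∈
    ... | inj₁ z≡x = x≢z (sym z≡x)
    ... | inj₂ z≡y = y≢z (sym z≡y)

  record Three (p : Subset n) : Set where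
    constructor three
    field
      {x y z}    : Fin n
      x∈p        : x ∈ p
      y∈p        : y ∈ p
      z∈p        : z ∈ p
      x≢y        : x ≢ y
      x≢z        : x ≢ z
      y≢z        : y ≢ z

  three⇒3≤∣p∣ : ∀ {p : Subset n} → Three p → 3 ≤ ∣ p ∣
  three⇒3≤∣p∣ (three x∈p y∈p z∈p x≢y x≢z y≢z) =
    ≤-trans (≤-reflexive (sym (∣⁅x⁆∪⁅y⁆∪⁅z⁆∣≡3 x≢y x≢z y≢z)))
            (p⊆q⇒∣p∣≤∣q∣ (∪-⊆ (⁅x⁆∪⁅y⁆⊆p x∈p y∈p) (⁅x⁆⊆p z∈p)))

  data Shape (p : Subset n) : Set where
    empty : p ⊆ ∅ → Shape p
    pair  : ∀ {x y} → x ∈ p → y ∈ p → p ⊆ ⁅ x ⁆ ∪ ⁅ y ⁆ → Shape p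
    many  : Three p → Shape p

  shape : ∀ p → Shape p
  shape p with any? (_∈? p)
  ... | no ∄x = empty λ u∈p → ⊥-elim (∄x (_ , u∈p))
  ... | yes (x , x∈p) with any? (λ y → y ∈? p ×-dec ¬? (x ≟ᶠ y))
  ...   | no ∄y = pair x∈p x∈p only-x
    where
    only-x : p ⊆ ⁅ x ⁆ ∪ ⁅ x ⁆
    only-x {u} u∈p with x ≟ᶠ u
    ... | yes refl = x∈p∪q⁺ (inj₁ (x∈⁅x⁆ u))
    ... | no  x≢u  = ⊥-elim (∄y (u , u∈p , x≢u))
  ...   | yes (y , y∈p , x≢y) with any? (λ z → z ∈? p ×-dec ¬? (x ≟ᶠ z) ×-dec ¬? (y ≟ᶠ z))
  ...     | yes (z , z∈p , x≢z , y≢z) = many (three x∈p y∈p z∈p x≢y x≢z y≢z)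
  ...     | no ∄z = pair x∈p y∈p only-xy
    where
    only-xy : p ⊆ ⁅ x ⁆ ∪ ⁅ y ⁆
    only-xy {u} u∈p with x ≟ᶠ u | y ≟ᶠ u
    ... | yes refl | _        = x∈p∪q⁺ (inj₁ (x∈⁅x⁆ u))
    ... | no _     | yes refl = x∈p∪q⁺ (inj₂ (x∈⁅x⁆ u))
    ... | no x≢u   | no y≢u   = ⊥-elim (∄z (u , u∈p , x≢u , y≢u))

  ⊆∅⇒∣p∣≡0 : ∀ {p : Subset n} → p ⊆ ∅ → ∣ p ∣ ≡ 0
  ⊆∅⇒∣p∣≡0 p⊆∅ = n≤0⇒n≡0 (≤-trans (p⊆q⇒∣p∣≤∣q∣ p⊆∅) (≤-reflexive (∣⊥∣≡0 n)))

  ⊆⁅x⁆∪⁅y⁆⇒∣p∣≤2 : ∀ {p : Subset n} {x y} → p ⊆ ⁅ x ⁆ ∪ ⁅ y ⁆ → ∣ p ∣ ≤ 2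
  ⊆⁅x⁆∪⁅y⁆⇒∣p∣≤2 {x = x} {y} p⊆ = ≤-trans (p⊆q⇒∣p∣≤∣q∣ p⊆) (∣⁅x⁆∪⁅y⁆∣≤2 x y)

  ⊆⁅x⁆∪⁅x⁆⇒∣p∣≤1 : ∀ {p : Subset n} {x} → p ⊆ ⁅ x ⁆ ∪ ⁅ x ⁆ → ∣ p ∣ ≤ 1
  ⊆⁅x⁆∪⁅x⁆⇒∣p∣≤1 {x = x} p⊆ =
    ≤-trans (p⊆q⇒∣p∣≤∣q∣ p⊆) (≤-reflexive (trans (cong ∣_∣ (∪-idem ⁅ x ⁆)) (∣⁅x⁆∣≡1 x)))

  2<∣p∣⇒three : ∀ {p : Subset n} → 2 < ∣ p ∣ → Three p
  2<∣p∣⇒three {p} 2<∣p∣ with shape p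
  ... | empty p⊆∅      = ⊥-elim (<⇒≱ 2<∣p∣ (subst (_≤ 2) (sym (⊆∅⇒∣p∣≡0 p⊆∅)) z≤n))
  ... | pair _ _ p⊆x∪y = ⊥-elim (<⇒≱ 2<∣p∣ (⊆⁅x⁆∪⁅y⁆⇒∣p∣≤2 p⊆x∪y))
  ... | many t         = t

  ∣p∣≡2⇒pair : ∀ {p : Subset n} → ∣ p ∣ ≡ 2 →
               ∃₂ λ x y → x ≢ y × x ∈ p × y ∈ p × p ⊆ ⁅ x ⁆ ∪ ⁅ y ⁆
  ∣p∣≡2⇒pair {p} ∣p∣≡2 with shape p
  ... | empty p⊆∅ = case trans (sym ∣p∣≡2) (⊆∅⇒∣p∣≡0 p⊆∅) of λ ()
  ... | many t    = ⊥-elim (<⇒≱ (three⇒3≤∣p∣ t) (≤-reflexive ∣p∣≡2))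
  ... | pair {x} {y} x∈p y∈p p⊆x∪y with x ≟ᶠ y
  ...   | no x≢y   = x , y , x≢y , x∈p , y∈p , p⊆x∪y
  ...   | yes refl = ⊥-elim (<⇒≱ (≤-reflexive (sym ∣p∣≡2)) (⊆⁅x⁆∪⁅x⁆⇒∣p∣≤1 p⊆x∪y))

  select : ∀ {ℓ} {P : Pred (Fin n) ℓ} → Decidable₁ P → Subset n
  select P? = tabulate (isYes ∘ P?)

  ∈-select : ∀ {ℓ} {P : Pred (Fin n) ℓ} (P? : Decidable₁ P) {x} → x ∈ select P? ⇔ P x
  ∈-select P? {x} = mk⇔
    (λ x∈ → Equivalence.to (isYes≡true⇔ (P? x)) (trans (sym (lookup∘tabulate (isYes ∘ P?) x)) ([]=⇒lookup x∈)))
    (λ Px → lookup⇒[]= x _ (trans (lookup∘tabulate (isYes ∘ P?) x) (Equivalence.from (isYes≡true⇔ (P? x)) Px)))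

  Crosses : Subset n → Fin n → Fin n → Set
  Crosses A u v = (u ∈ A × v ∉ A) ⊎ (u ∉ A × v ∈ A)

  crosses-twice⇒¬crosses : ∀ {A x y z} → Crosses A x y → Crosses A y z → ¬ Crosses A x z
  crosses-twice⇒¬crosses (inj₁ (_ , y∉)) (inj₁ (y∈ , _)) _               = y∉ y∈
  crosses-twice⇒¬crosses (inj₂ (_ , y∈)) (inj₂ (y∉ , _)) _               = y∉ y∈
  crosses-twice⇒¬crosses (inj₁ _)        (inj₂ (_ , z∈)) (inj₁ (_ , z∉)) = z∉ z∈
  crosses-twice⇒¬crosses (inj₁ (x∈ , _)) (inj₂ _)        (inj₂ (x∉ , _)) = x∉ x∈
  crosses-twice⇒¬crosses (inj₂ (x∉ , _)) (inj₁ _)        (inj₁ (x∈ , _)) = x∉ x∈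
  crosses-twice⇒¬crosses (inj₂ _)        (inj₁ (_ , z∉)) (inj₂ (_ , z∈)) = z∉ z∈

module _ {n ℓ} {_≈_ : Rel (Fin n) ℓ} (≈-isDecEquivalence : IsDecEquivalence _≈_) where
  open IsDecEquivalence ≈-isDecEquivalence using (_≟_) renaming (sym to ≈-sym; trans to ≈-trans)

  classOf : Fin n → Subset n
  classOf a = select (a ≟_)

  ∈-classOf : ∀ {a x} → x ∈ classOf a ⇔ a ≈ x
  ∈-classOf {a} = ∈-select (a ≟_)

  crosses-classOf⇔≉ : (∀ {x y z} → ¬ x ≈ y → ¬ x ≈ z → ¬ y ≈ z → ⊥) →
                      ∀ a {u v} → Crosses (classOf a) u v ⇔ (¬ u ≈ v)
  crosses-classOf⇔≉ at-most-two a {u} {v} = mk⇔ to from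
    where
    ∈⇒≈ : ∀ {x} → x ∈ classOf a → a ≈ x
    ∈⇒≈ = Equivalence.to ∈-classOf

    ≈⇒∈ : ∀ {x} → a ≈ x → x ∈ classOf a
    ≈⇒∈ = Equivalence.from ∈-classOf

    to : Crosses (classOf a) u v → ¬ u ≈ v
    to (inj₁ (u∈ , v∉)) u≈v = v∉ (≈⇒∈ (≈-trans (∈⇒≈ u∈) u≈v))
    to (inj₂ (u∉ , v∈)) u≈v = u∉ (≈⇒∈ (≈-trans (∈⇒≈ v∈) (≈-sym u≈v)))

    from : ¬ u ≈ v → Crosses (classOf a) u v
    from u≉v with a ≟ u | a ≟ v
    ... | yes a≈u | yes a≈v = ⊥-elim (u≉v (≈-trans (≈-sym a≈u) a≈v))
    ... | yes a≈u | no  a≉v = inj₁ (≈⇒∈ a≈u , a≉v ∘ ∈⇒≈)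
    ... | no  a≉u | yes a≈v = inj₂ (a≉u ∘ ∈⇒≈ , ≈⇒∈ a≈v)
    ... | no  a≉u | no  a≉v = ⊥-elim (at-most-two a≉u a≉v u≉v)

module _ {n : ℕ} (C : Complex n) where

  Edge-refl : ∀ x → Edge C x x
  Edge-refl x = downClosed C ⁅ x ⁆ _ (∪-⊆ (λ u∈ → u∈) (λ u∈ → u∈)) (singletons C x)

  Edge-sym : ∀ {x y} → Edge C x y → Edge C y x
  Edge-sym = downClosed C _ _ (∪-⊆ (λ u∈ → x∈p∪q⁺ (inj₂ u∈)) (λ u∈ → x∈p∪q⁺ (inj₁ u∈)))

  Edge? : ∀ x y → Dec (Edge C x y)
  Edge? x y = H C (⁅ x ⁆ ∪ ⁅ y ⁆) ≟ᵇ true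

  Adjacent : Fin n → Fin n → Set
  Adjacent x y = x ≢ y × Edge C x y

  Adjacent-sym : ∀ {x y} → Adjacent x y → Adjacent y x
  Adjacent-sym (x≢y , e) = x≢y ∘ sym , Edge-sym e

  Adjacent? : ∀ x y → Dec (Adjacent x y)
  Adjacent? x y = ¬? (x ≟ᶠ y) ×-dec Edge? x y

  Clique : Subset n → Set
  Clique X = ∀ {u v} → u ∈ X → v ∈ X → Edge C u v

  clique? : ∀ X → Dec (Clique X)
  clique? X = map′ (λ c u∈ v∈ → c _ _ u∈ v∈) (λ c _ _ → c)
                   (all? λ u → all? λ v → u ∈? X →-dec (v ∈? X →-dec Edge? u v))

  face⇒clique : ∀ {X} → H C X ≡ true → Clique X
  face⇒clique X∈H u∈ v∈ = downClosed C _ _ (⁅x⁆∪⁅y⁆⊆p u∈ v∈) X∈H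

  clique-⊆ : ∀ {X Y} → Y ⊆ X → Clique X → Clique Y
  clique-⊆ Y⊆X cl u∈ v∈ = cl (Y⊆X u∈) (Y⊆X v∈)

  clique-⁅x⁆ : ∀ x → Clique ⁅ x ⁆
  clique-⁅x⁆ x u∈ v∈ rewrite x∈⁅y⁆⇒x≡y x u∈ | x∈⁅y⁆⇒x≡y x v∈ = Edge-refl x

  clique-∪⁅⁆ : ∀ {X i} → Clique X → (∀ {u} → u ∈ X → Edge C u i) → Clique (X ∪ ⁅ i ⁆)
  clique-∪⁅⁆ {X} {i} cl X—i u∈ v∈ with x∈p∪q⁻ X ⁅ i ⁆ u∈ | x∈p∪q⁻ X ⁅ i ⁆ v∈
  ... | inj₁ u∈X | inj₁ v∈X = cl u∈X v∈X
  ... | inj₁ u∈X | inj₂ v∈i rewrite x∈⁅y⁆⇒x≡y i v∈i = X—i u∈X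
  ... | inj₂ u∈i | inj₁ v∈X rewrite x∈⁅y⁆⇒x≡y i u∈i = Edge-sym (X—i v∈X)
  ... | inj₂ u∈i | inj₂ v∈i rewrite x∈⁅y⁆⇒x≡y i u∈i | x∈⁅y⁆⇒x≡y i v∈i = Edge-refl i

  Triangle : Set
  Triangle = ∃₂ λ x y → ∃ λ z → Adjacent x y × Adjacent x z × Adjacent y z

  triangle? : Dec Triangle
  triangle? = any? λ x → any? λ y → any? λ z → Adjacent? x y ×-dec Adjacent? x z ×-dec Adjacent? y z

  triangle-clique : ∀ {x y z} → Adjacent x y → Adjacent x z → Adjacent y z → Clique ((⁅ x ⁆ ∪ ⁅ y ⁆) ∪ ⁅ z ⁆)
  triangle-clique {x} {y} {z} (_ , x—y) (_ , x—z) (_ , y—z) =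
    clique-∪⁅⁆ (clique-∪⁅⁆ (clique-⁅x⁆ x) λ u∈ → subst (λ u → Edge C u y) (sym (x∈⁅y⁆⇒x≡y x u∈)) x—y)
               λ u∈ → case ∈⁅x⁆∪⁅y⁆⁻ u∈ of λ { (inj₁ refl) → x—z ; (inj₂ refl) → y—z }

  three⇒triangle : ∀ {X} → (∀ {u v} → u ∈ X → v ∈ X → u ≢ v → Edge C u v) → Three X → Triangle
  three⇒triangle X—X (three x∈ y∈ z∈ x≢y x≢z y≢z) =
    _ , _ , _ , (x≢y , X—X x∈ y∈ x≢y) , (x≢z , X—X x∈ z∈ x≢z) , (y≢z , X—X y∈ z∈ y≢z)

  ∣triangle∣≡3 : ∀ {x y z} → Adjacent x y → Adjacent x z → Adjacent y z → ∣ (⁅ x ⁆ ∪ ⁅ y ⁆) ∪ ⁅ z ⁆ ∣ ≡ 3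
  ∣triangle∣≡3 (x≢y , _) (x≢z , _) (y≢z , _) = ∣⁅x⁆∪⁅y⁆∪⁅z⁆∣≡3 x≢y x≢z y≢z

  face₂⇒adjacent : ∀ {X} → H C X ≡ true → ∣ X ∣ ≡ 2 → ∃₂ Adjacent
  face₂⇒adjacent X∈H ∣X∣≡2 with ∣p∣≡2⇒pair ∣X∣≡2
  ... | x , y , x≢y , x∈ , y∈ , _ = x , y , x≢y , face⇒clique X∈H x∈ y∈

  hasTriangle⇒triangle : HasTriangle C → Triangle
  hasTriangle⇒triangle (X , ∣X∣≡3 , pairs∈H) =
    three⇒triangle (λ u∈ v∈ u≢v → pairs∈H _ (⁅x⁆∪⁅y⁆⊆p u∈ v∈) (∣⁅x⁆∪⁅y⁆∣≡2 u≢v))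
                   (2<∣p∣⇒three (≤-reflexive (sym ∣X∣≡3)))

  completeBipartite⇒¬triangle : IsCompleteBipartite C → ¬ Triangle
  completeBipartite⇒¬triangle (A , _ , _ , edge⇔crosses) (_ , _ , _ , x—y , x—z , y—z) =
    crosses-twice⇒¬crosses (crosses x—y) (crosses y—z) (crosses x—z)
    where
    crosses : ∀ {u v} → Adjacent u v → Crosses A u v
    crosses (u≢v , u—v) = Equivalence.to (edge⇔crosses _ _ u≢v) u—v

  DimensionAtMost : ℕ → Set
  DimensionAtMost d = ∀ X → H C X ≡ true → ∣ X ∣ ≤ suc d

  ¬triangle⇒extensions-trivial : DimensionAtMost 1 → ¬ Triangle →
                                 ∀ {C'} → IsExtension 1 C C' → ∀ X → H C' X ≡ H C X
  ¬triangle⇒extensions-trivial dim ∄△ {C'} ext X with ∣ X ∣ ≤? 2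
  ... | yes ∣X∣≤2 = ext X ∣X∣≤2
  ... | no  ∣X∣≰2 = ⇔→≡ (mk⇔ (⊥-elim ∘ X∉C') (⊥-elim ∘ ∣X∣≰2 ∘ dim X))
    where
    X∉C' : ¬ H C' X ≡ true
    X∉C' X∈C' = ∄△ (three⇒triangle (λ u∈ v∈ _ → edge u∈ v∈) (2<∣p∣⇒three (≰⇒> ∣X∣≰2)))
      where
      edge : ∀ {u v} → u ∈ X → v ∈ X → Edge C u v
      edge {u} {v} u∈ v∈ = trans (sym (ext _ (∣⁅x⁆∪⁅y⁆∣≤2 u v))) (downClosed C' X _ (⁅x⁆∪⁅y⁆⊆p u∈ v∈) X∈C')

  Clique≤3 : Subset n → Set
  Clique≤3 X = ∣ X ∣ ≤ 3 × Clique X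

  clique≤3? : ∀ X → Dec (Clique≤3 X)
  clique≤3? X = ∣ X ∣ ≤? 3 ×-dec clique? X

  clique≤3⇔ : ∀ {X} → isYes (clique≤3? X) ≡ true ⇔ Clique≤3 X
  clique≤3⇔ {X} = isYes≡true⇔ (clique≤3? X)

  cliqueComplex₂ : Complex n
  cliqueComplex₂ = record
    { H          = isYes ∘ clique≤3?
    ; singletons = λ x → Equivalence.from clique≤3⇔ (≤-trans (≤-reflexive (∣⁅x⁆∣≡1 x)) (s≤s z≤n) , clique-⁅x⁆ x)
    ; downClosed = λ X Y Y⊆X X∈ → let ∣X∣≤3 , X-clique = Equivalence.to clique≤3⇔ X∈ in
                     Equivalence.from clique≤3⇔ (≤-trans (p⊆q⇒∣p∣≤∣q∣ Y⊆X) ∣X∣≤3 , clique-⊆ Y⊆X X-clique)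
    }

  face⇒clique≤3 : ∀ {X} → H cliqueComplex₂ X ≡ true → Clique≤3 X
  face⇒clique≤3 = Equivalence.to clique≤3⇔

  clique≤3⇒face : ∀ {X} → Clique≤3 X → H cliqueComplex₂ X ≡ true
  clique≤3⇒face = Equivalence.from clique≤3⇔

  cone-over-pair : ∀ {J p q i} → J ⊆ ⁅ p ⁆ ∪ ⁅ q ⁆ → Clique J → Adjacent i p → Adjacent i q →
                   i ∉ J × Clique≤3 (J ∪ ⁅ i ⁆)
  cone-over-pair {J} {p} {q} {i} J⊆pq J-clique (i≢p , i—p) (i≢q , i—q) =
    i∉J , ≤-trans (∣p∪⁅x⁆∣≤1+∣p∣ J i) (s≤s (⊆⁅x⁆∪⁅y⁆⇒∣p∣≤2 J⊆pq)) , clique-∪⁅⁆ J-clique J—i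
    where
    i∉J : i ∉ J
    i∉J i∈J with ∈⁅x⁆∪⁅y⁆⁻ (J⊆pq i∈J)
    ... | inj₁ i≡p = i≢p i≡p
    ... | inj₂ i≡q = i≢q i≡q

    J—i : ∀ {u} → u ∈ J → Edge C u i
    J—i u∈J with ∈⁅x⁆∪⁅y⁆⁻ (J⊆pq u∈J)
    ... | inj₁ refl = Edge-sym i—p
    ... | inj₂ refl = Edge-sym i—q

module _ {m : ℕ} (C : Complex (suc m)) where

  small-clique⇒face : ∀ {X} → Clique C X → ∣ X ∣ ≤ 2 → H C X ≡ true
  small-clique⇒face {X} X-clique ∣X∣≤2 with shape X
  ... | empty X⊆∅    = downClosed C ⁅ zero ⁆ X (λ u∈ → ⊥-elim (∉⊥ (X⊆∅ u∈))) (singletons C zero)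
  ... | pair x∈ y∈ X⊆ = downClosed C _ X X⊆ (X-clique x∈ y∈)
  ... | many t       = ⊥-elim (<⇒≱ (three⇒3≤∣p∣ t) ∣X∣≤2)

  triangle⇒hasTriangle : Triangle C → HasTriangle C
  triangle⇒hasTriangle (_ , _ , _ , x—y , x—z , y—z) =
    _ , ∣triangle∣≡3 C x—y x—z y—z ,
    λ Y Y⊆T ∣Y∣≡2 → small-clique⇒face (clique-⊆ C Y⊆T (triangle-clique C x—y x—z y—z)) (≤-reflexive ∣Y∣≡2)

  cliqueComplex₂-extends : IsExtension 1 C (cliqueComplex₂ C)
  cliqueComplex₂-extends X ∣X∣≤2 = ⇔→≡ (mk⇔
    (λ X∈ → small-clique⇒face (proj₂ (face⇒clique≤3 C X∈)) ∣X∣≤2)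
    (λ X∈H → clique≤3⇒face C (≤-trans ∣X∣≤2 (n≤1+n 2) , face⇒clique C X∈H)))

  cliqueComplex₂-face⇒face : ∀ {X} → ∣ X ∣ ≤ 2 → H (cliqueComplex₂ C) X ≡ true → H C X ≡ true
  cliqueComplex₂-face⇒face {X} ∣X∣≤2 = trans (sym (cliqueComplex₂-extends X ∣X∣≤2))

  cliqueComplex₂-proper : DimensionAtMost C 1 → Triangle C → IsProper C (cliqueComplex₂ C)
  cliqueComplex₂-proper dim (x , y , z , x—y , x—z , y—z) same =
    <⇒≱ (≤-reflexive (sym ∣T∣≡3)) (dim T (trans (sym (same T)) T∈cliqueComplex₂))
    where
    T : Subset (suc m)
    T = (⁅ x ⁆ ∪ ⁅ y ⁆) ∪ ⁅ z ⁆

    ∣T∣≡3 : ∣ T ∣ ≡ 3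
    ∣T∣≡3 = ∣triangle∣≡3 C x—y x—z y—z

    T∈cliqueComplex₂ : H (cliqueComplex₂ C) T ≡ true
    T∈cliqueComplex₂ = clique≤3⇒face C (≤-reflexive ∣T∣≡3 , triangle-clique C x—y x—z y—z)

module _ {m : ℕ} (C : Complex (suc m)) (C-isMatroid : IsMatroid C) where

  NonAdjacent : Rel (Fin (suc m)) 0ℓ
  NonAdjacent x y = ¬ Adjacent C x y

  nonAdjacent-trans : Transitive NonAdjacent
  nonAdjacent-trans {u} {v} {w} u≁v v≁w (u≢w , u—w)
    with C-isMatroid (⁅ u ⁆ ∪ ⁅ w ⁆) ⁅ v ⁆ u—w (singletons C v)
                     (trans (∣⁅x⁆∪⁅y⁆∣≡2 u≢w) (cong suc (sym (∣⁅x⁆∣≡1 v))))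
  ... | i , i∈uw , i∉v , v—i with ∈⁅x⁆∪⁅y⁆⁻ i∈uw
  ...   | inj₁ refl = u≁v (x∉⁅y⁆⇒x≢y i∉v , Edge-sym C v—i)
  ...   | inj₂ refl = v≁w (x∉⁅y⁆⇒x≢y i∉v ∘ sym , v—i)

  nonAdjacent-isDecEquivalence : IsDecEquivalence NonAdjacent
  nonAdjacent-isDecEquivalence = record
    { isEquivalence = record
      { refl  = λ (x≢x , _) → x≢x refl
      ; sym   = λ x≁y → x≁y ∘ Adjacent-sym C
      ; trans = nonAdjacent-trans
      }
    ; _≟_ = λ x y → ¬? (Adjacent? C x y)
    }

  ¬nonAdjacent⇒adjacent : ∀ {x y} → ¬ NonAdjacent x y → Adjacent C x y
  ¬nonAdjacent⇒adjacent = decidable-stable (Adjacent? C _ _)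

  ¬triangle⇒completeBipartite : ¬ Triangle C → ∀ {a b} → Adjacent C a b → IsCompleteBipartite C
  ¬triangle⇒completeBipartite ∄△ {a} {b} a—b =
    A , (a , Equivalence.from ∈A⇔ (λ (a≢a , _) → a≢a refl)) , (b , λ b∈A → Equivalence.to ∈A⇔ b∈A a—b) ,
    λ u v u≢v → mk⇔ (λ u—v → Equivalence.from crosses⇔ λ u≁v → u≁v (u≢v , u—v))
                    (proj₂ ∘ ¬nonAdjacent⇒adjacent ∘ Equivalence.to crosses⇔)
    where
    A : Subset (suc m)
    A = classOf nonAdjacent-isDecEquivalence a

    ∈A⇔ : ∀ {x} → x ∈ A ⇔ NonAdjacent a x
    ∈A⇔ = ∈-classOf nonAdjacent-isDecEquivalence

    at-most-two : ∀ {x y z} → ¬ NonAdjacent x y → ¬ NonAdjacent x z → ¬ NonAdjacent y z → ⊥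
    at-most-two x—y x—z y—z =
      ∄△ (_ , _ , _ , ¬nonAdjacent⇒adjacent x—y , ¬nonAdjacent⇒adjacent x—z , ¬nonAdjacent⇒adjacent y—z)

    crosses⇔ : ∀ {u v} → Crosses A u v ⇔ (¬ NonAdjacent u v)
    crosses⇔ = crosses-classOf⇔≉ nonAdjacent-isDecEquivalence at-most-two a

  triangle-exchange : ∀ {I J} → Three I → Clique C I → ∣ J ∣ ≡ 2 → Clique C J →
                      ∃ λ i → i ∈ I × i ∉ J × Clique≤3 C (J ∪ ⁅ i ⁆)
  triangle-exchange {I} (three x∈ y∈ z∈ x≢y x≢z y≢z) I-clique ∣J∣≡2 J-clique
    with ∣p∣≡2⇒pair ∣J∣≡2
  ... | p , q , _ , _ , _ , J⊆pq
    with ≉-avoid₂ nonAdjacent-isDecEquivalence {P = _∈ I} x∈ y∈ z∈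
           (λ x≁y → x≁y (x≢y , I-clique x∈ y∈)) (λ x≁z → x≁z (x≢z , I-clique x∈ z∈))
           (λ y≁z → y≁z (y≢z , I-clique y∈ z∈)) p q
  ... | i , i∈I , i≁p , i≁q =
    i , i∈I , cone-over-pair C J⊆pq J-clique (¬nonAdjacent⇒adjacent i≁p) (¬nonAdjacent⇒adjacent i≁q)

  cliqueComplex₂-isMatroid : DimensionAtMost C 1 → IsMatroid (cliqueComplex₂ C)
  cliqueComplex₂-isMatroid dim I J I∈ J∈ ∣I∣≡1+∣J∣ = exchange (∣ I ∣ ≤? 2)
    where
    exchange : Dec (∣ I ∣ ≤ 2) → ∃ λ i → i ∈ I × i ∉ J × H (cliqueComplex₂ C) (J ∪ ⁅ i ⁆) ≡ true
    exchange (yes ∣I∣≤2)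
      with C-isMatroid I J (cliqueComplex₂-face⇒face C ∣I∣≤2 I∈) (cliqueComplex₂-face⇒face C ∣J∣≤2 J∈)
                       ∣I∣≡1+∣J∣
      where
      ∣J∣≤2 : ∣ J ∣ ≤ 2
      ∣J∣≤2 = ≤-trans (n≤1+n ∣ J ∣) (≤-trans (≤-reflexive (sym ∣I∣≡1+∣J∣)) ∣I∣≤2)
    ... | i , i∈I , i∉J , J+i∈H = i , i∈I , i∉J , trans (cliqueComplex₂-extends C _ (dim _ J+i∈H)) J+i∈H
    exchange (no ∣I∣≰2) with face⇒clique≤3 C I∈ | 2<∣p∣⇒three (≰⇒> ∣I∣≰2)
    ... | ∣I∣≤3 , I-clique | I-three
      with triangle-exchange I-three I-clique ∣J∣≡2 (proj₂ (face⇒clique≤3 C J∈))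
      where
      ∣J∣≡2 : ∣ J ∣ ≡ 2
      ∣J∣≡2 = suc-injective (trans (sym ∣I∣≡1+∣J∣) (≤-antisym ∣I∣≤3 (three⇒3≤∣p∣ I-three)))
    ... | i , i∈I , i∉J , J+i-clique = i , i∈I , i∉J , clique≤3⇒face C J+i-clique

proposition9p6 : ∀ (m : ℕ) (C : Complex (suc m)) → IsMatroid C → HasDimension C 1 →
    (AdmitsProperMatroidExtension 1 C ⇔ (¬ IsCompleteBipartite C))
    × ((¬ IsCompleteBipartite C) ⇔ HasTriangle C)
proposition9p6 m C C-isMatroid ((X , X∈H , ∣X∣≡2) , dim) = mk⇔ i⇒ii ii⇒i , mk⇔ ii⇒iii iii⇒ii
  where
  ¬cb⇒triangle : ¬ IsCompleteBipartite C → Triangle C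
  ¬cb⇒triangle ¬cb = decidable-stable (triangle? C) λ ∄△ →
    ¬cb (¬triangle⇒completeBipartite C C-isMatroid ∄△ (proj₂ (proj₂ (face₂⇒adjacent C X∈H ∣X∣≡2))))

  i⇒ii : AdmitsProperMatroidExtension 1 C → ¬ IsCompleteBipartite C
  i⇒ii (C' , extends , proper , _) cb =
    proper (¬triangle⇒extensions-trivial C dim (completeBipartite⇒¬triangle C cb) {C'} extends)

  ii⇒i : ¬ IsCompleteBipartite C → AdmitsProperMatroidExtension 1 C
  ii⇒i ¬cb = cliqueComplex₂ C , cliqueComplex₂-extends C ,
             cliqueComplex₂-proper C dim (¬cb⇒triangle ¬cb) , cliqueComplex₂-isMatroid C C-isMatroid dim

  ii⇒iii : ¬ IsCompleteBipartite C → HasTriangle C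
  ii⇒iii = triangle⇒hasTriangle C ∘ ¬cb⇒triangle

  iii⇒ii : HasTriangle C → ¬ IsCompleteBipartite C
  iii⇒ii △ cb = completeBipartite⇒¬triangle C cb (hasTriangle⇒triangle C △)
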